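{- Let $k\ge1$ and $0\le t\le k$ be integers, $n\ge 1$, and $1\le r\le n$. Then \[ s_{n,t,n-r}=C_{n+1,t}-(k+1)C_{n,t}-\sum_{j=2}^{r}\frac{1}{j-1}\binom{(j-1)(k+1)}{j}C_{n-j+1,t}. \]
   Context: A $k_t$-Dyck path is a lattice path consisting of up-steps $(1,k)$ and down-steps $(1,-1)$ that starts at $(0,0)$, stays weakly above the line $y=-t$, and ends on the line $y=0$. For $n\ge 1$ and $0\le m\le n$, $s_{n,t,m}$ denotes the total number, over all $k_t$-Dyck paths with $n$ up-steps, of down-steps between the $m$-th and $(m+1)$-th up-steps (before the first up-step if $m=0$, after the last if $m=n$). For integers $m,j\ge0$, $C_{m,j}=\frac{j+1}{(k+1)m+j+1}\binom{(k+1)m+j+1}{m}$. -}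

module Defs where

open import Data.Nat as ℕ using (ℕ; zero; suc; _≡ᵇ_)
open import Data.Nat.Combinatorics using (_C_)
open import Data.Integer using (+_)
open import Data.Rational as ℚ using (ℚ; _/_; 0ℚ)
open import Data.Bool using (Bool; true; false; _∧_; if_then_else_)
open import Data.List using (List; []; _∷_; map; _++_; foldr)

-- Steps of a k_t-Dyck path: U = up-step (1,k), D = down-step (1,-1).
data Step : Set where
  U D : Step

allSeqs : ℕ → List (List Step)
allSeqs zero = [] ∷ []
allSeqs (suc L) = map (U ∷_) (allSeqs L) ++ map (D ∷_) (allSeqs L)

ups : List Step → ℕ
ups [] = 0
ups (U ∷ xs) = suc (ups xs)
ups (D ∷ xs) = ups xs

-- validFrom k t h xs : the path xs, started at height y = h - t
-- (h ≥ 0 is the height shifted by t), never goes below y = -t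
-- (i.e. shifted height never negative) and ends at y = 0.
validFrom : ℕ → ℕ → ℕ → List Step → Bool
validFrom k t h [] = h ≡ᵇ t
validFrom k t h (U ∷ xs) = validFrom k t (h ℕ.+ k) xs
validFrom k t zero (D ∷ xs) = false
validFrom k t (suc h) (D ∷ xs) = validFrom k t h xs

isDyck : ℕ → ℕ → ℕ → List Step → Bool
isDyck k t n xs = validFrom k t t xs ∧ (ups xs ≡ᵇ n)

-- Number of down-steps between the m-th and (m+1)-th up-steps
-- (before the first up-step if m = 0, after the last if m = #ups).
downsAt : ℕ → List Step → ℕ
downsAt m [] = 0
downsAt zero (D ∷ xs) = suc (downsAt zero xs)
downsAt (suc m) (D ∷ xs) = downsAt (suc m) xs
downsAt zero (U ∷ xs) = 0
downsAt (suc m) (U ∷ xs) = downsAt m xs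

-- Every k_t-Dyck path with n up-steps ends at
-- y = 0, hence has exactly n*k down-steps and length n*(k+1); so summing
-- over all step sequences of that length enumerates all such paths.
s : ℕ → ℕ → ℕ → ℕ → ℕ
s k t n m = foldr (λ xs acc → (if isDyck k t n xs then downsAt m xs else 0) ℕ.+ acc)
                  0 (allSeqs (n ℕ.* suc k))

Cq : ℕ → ℕ → ℕ → ℚ
Cq k m j = ((+ suc j) / suc (suc k ℕ.* m ℕ.+ j)) ℚ.* ((+ ((suc (suc k ℕ.* m ℕ.+ j)) C m)) / 1)

toℚ : ℕ → ℚ
toℚ a = (+ a) / 1

-- Σ_{j=2}^{r} 1/(j-1) * binom((j-1)(k+1), j) * C_{n-j+1,t}
-- written with j = i + 2; sumTerm k t n r sums i = 0 .. r-2.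
term : ℕ → ℕ → ℕ → ℕ → ℚ
term k t n i = ((+ 1) / suc i) ℚ.* (toℚ ((suc i ℕ.* suc k) C (suc (suc i))) ℚ.* Cq k (n ℕ.∸ suc i) t)
  -- here j = i+2, j-1 = suc i, n-j+1 = n ∸ (i+1)  (valid since j ≤ r ≤ n)

sumUpTo : (ℕ → ℚ) → ℕ → ℚ
sumUpTo f zero = 0ℚ
sumUpTo f (suc c) = sumUpTo f c ℚ.+ f c

sumTerms : ℕ → ℕ → ℕ → ℕ → ℚ
sumTerms k t n r = sumUpTo (term k t n) (r ℕ.∸ 1)

module Submission where

-- Let W(z) = 1 + z·W(z)^(k+1) be the Fuss–Catalan series (K = k+1).  Measuring heights
-- from the floor y = -t, a path with u up-steps from height h to the end height t (≤ k)
-- is counted by the ballot number [z^u] W^(h+1).  Splitting a path at its first step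
-- turns both the path count and the down-step statistic into Pascal-type recurrences;
-- the statistic for the down-steps after the (n-r)-th up-step is solved by the partial
-- convolution Σ_{i ≤ r} [z^i] W^(-K) · [z^(n+1-i)] W^(t+1).  Its first two weights are
-- 1 and -K, the others -1/(i-1)·binom((i-1)K, i), and [z^u] W^(t+1) = C_{u,t}.

open import Defs
open import Data.Nat as ℕ using (ℕ; zero; suc; _≤_; _<_; s≤s)
import Data.Nat.Properties as ℕP
open import Data.Integer as ℤ using (ℤ; +_)
import Data.Integer.Properties as ℤP
open import Relation.Binary.PropositionalEquality
  using (_≡_; refl; sym; trans; cong; cong₂; subst; module ≡-Reasoning)

module Binomial where
  open import Data.Nat using (_+_; _*_)
  open import Data.Nat.Combinatorics using (_C_; nCk+nC[k+1]≡[n+1]C[k+1])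
  open import Data.Nat.Tactic.RingSolver using (solve-∀)
  open ≡-Reasoning

  -- Unlike the library's _C_, this binomial computes by pattern matching,
  -- which keeps the case analyses below definitional.
  binom : ℕ → ℕ → ℕ
  binom n zero = 1
  binom zero (suc j) = 0
  binom (suc n) (suc j) = binom n j + binom n (suc j)

  binom-1 : ∀ n → binom n 1 ≡ n
  binom-1 zero = refl
  binom-1 (suc n) = cong suc (binom-1 n)

  binom≡C : ∀ n j → binom n j ≡ n C j
  binom≡C n zero = refl
  binom≡C zero (suc j) = refl
  binom≡C (suc n) (suc j) =
    trans (cong₂ _+_ (binom≡C n j) (binom≡C n (suc j))) (nCk+nC[k+1]≡[n+1]C[k+1] n j)

  binom-absorb : ∀ n j → suc j * binom (suc n) (suc j) ≡ suc n * binom n j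
  binom-absorb zero zero = refl
  binom-absorb zero (suc j) = ℕP.*-zeroʳ (suc (suc j))
  binom-absorb (suc n) zero = begin
    binom (suc (suc n)) 1 + 0 ≡⟨ ℕP.+-identityʳ _ ⟩
    binom (suc (suc n)) 1     ≡⟨ binom-1 (suc (suc n)) ⟩
    suc (suc n)               ≡⟨ ℕP.*-identityʳ (suc (suc n)) ⟨
    suc (suc n) * 1           ∎
  binom-absorb (suc n) (suc j) = pascal-step (binom-absorb n j) (binom-absorb n (suc j))
    where
    -- With a = binom n j, b = binom n (j+1) and y = binom (n+1) (j+2), the two
    -- instances of the induction hypothesis add up along Pascal's rule.
    pascal-step : ∀ {a b y} → suc j * (a + b) ≡ suc n * a → suc (suc j) * y ≡ suc n * b →
                  suc (suc j) * ((a + b) + y) ≡ suc (suc n) * (a + b)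
    pascal-step {a} {b} {y} ih₁ ih₂ = begin
      suc (suc j) * ((a + b) + y)                   ≡⟨ regroup j a b y ⟩
      (a + b) + suc j * (a + b) + suc (suc j) * y   ≡⟨ cong₂ (λ p q → (a + b) + p + q) ih₁ ih₂ ⟩
      (a + b) + suc n * a + suc n * b               ≡⟨ collect n a b ⟩
      suc (suc n) * (a + b)                         ∎
      where
      regroup : ∀ j a b y → suc (suc j) * ((a + b) + y) ≡ (a + b) + suc j * (a + b) + suc (suc j) * y
      regroup = solve-∀
      collect : ∀ n a b → (a + b) + suc n * a + suc n * b ≡ suc (suc n) * (a + b)
      collect = solve-∀

module IntegerSums where
  open import Data.Integer using (_+_; -_)
  open import Data.Integer.Tactic.RingSolver using (solve-∀)

  ∑ : (ℕ → ℤ) → ℕ → ℤ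
  ∑ f zero = + 0
  ∑ f (suc n) = ∑ f n + f n

  infix 6.5 ∑
  syntax ∑ (λ i → e) n = ∑[ i < n ] e

  ∑-cong : ∀ n {f g : ℕ → ℤ} → (∀ i → i < n → f i ≡ g i) → ∑ f n ≡ ∑ g n
  ∑-cong zero eq = refl
  ∑-cong (suc n) eq =
    cong₂ _+_ (∑-cong n (λ i i<n → eq i (ℕP.m<n⇒m<1+n i<n))) (eq n (ℕP.n<1+n n))

  ∑-zero : ∀ n (f : ℕ → ℤ) → (∀ i → i < n → f i ≡ + 0) → ∑ f n ≡ + 0
  ∑-zero zero f eq = refl
  ∑-zero (suc n) f eq =
    cong₂ _+_ (∑-zero n f (λ i i<n → eq i (ℕP.m<n⇒m<1+n i<n))) (eq n (ℕP.n<1+n n))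

  ∑-+ : ∀ n (f g : ℕ → ℤ) → ∑[ i < n ] (f i + g i) ≡ ∑ f n + ∑ g n
  ∑-+ zero f g = refl
  ∑-+ (suc n) f g =
    trans (cong (_+ (f n + g n)) (∑-+ n f g)) (interchange (∑ f n) (∑ g n) (f n) (g n))
    where
    interchange : ∀ (a b c d : ℤ) → (a + b) + (c + d) ≡ (a + c) + (b + d)
    interchange = solve-∀

  ∑-neg : ∀ n (f : ℕ → ℤ) → ∑[ i < n ] (- f i) ≡ - ∑ f n
  ∑-neg zero f = refl
  ∑-neg (suc n) f =
    trans (cong (_+ - f n) (∑-neg n f)) (sym (ℤP.neg-distrib-+ (∑ f n) (f n)))

  ∑-head : ∀ n (f : ℕ → ℤ) → ∑ f (suc n) ≡ f 0 + (∑[ i < n ] f (suc i))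
  ∑-head zero f = trans (ℤP.+-identityˡ (f 0)) (sym (ℤP.+-identityʳ (f 0)))
  ∑-head (suc n) f =
    trans (cong (_+ f (suc n)) (∑-head n f)) (ℤP.+-assoc (f 0) _ (f (suc n)))

module FussCatalan (k : ℕ) where
  open Binomial
  open IntegerSums
  open import Data.Nat using (_∸_)
  open import Data.Integer using (_+_; _*_; _-_; -_)
  open import Data.Integer.Tactic.RingSolver using (solve-∀)
  import Data.Nat.Tactic.RingSolver as ℕSolver
  open import Algebra.Properties.AbelianGroup ℤP.+-0-abelianGroup using (identityˡ-unique)
  open ≡-Reasoning

  K : ℕ
  K = suc k

  top : ℕ → ℕ → ℕ
  top α u = α ℕ.+ (u ℕ.* K ℕ.+ k)

  top-suc : ∀ α u → α ℕ.+ suc u ℕ.* K ≡ suc (top α u)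
  top-suc α u = arith α k u
    where
    arith : ∀ a c u → a ℕ.+ suc u ℕ.* suc c ≡ suc (a ℕ.+ (u ℕ.* suc c ℕ.+ c))
    arith = ℕSolver.solve-∀

  top-shift : ∀ α u → top (α ℕ.+ K) u ≡ top α (suc u)
  top-shift α u = arith α k u
    where
    arith : ∀ a c u → a ℕ.+ suc c ℕ.+ (u ℕ.* suc c ℕ.+ c) ≡ a ℕ.+ (suc u ℕ.* suc c ℕ.+ c)
    arith = ℕSolver.solve-∀

  -- F α u = [z^u] W(z)^(α-K), through its closed form
  --   binom(α + K(u-1), u) - K·binom(α + K(u-1) - 1, u-1)    (u ≥ 1).
  F : ℕ → ℕ → ℤ
  F α zero = + 1
  F α (suc zero) = + α - + K
  F α (suc (suc u)) = + binom (suc (top α u)) (suc (suc u)) - + K * + binom (top α u) (suc u)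

  -- Pascal recurrence, from W^(s+1) = z·W^(s+K) + W^s with s = α - K.
  F-pascal : ∀ α u → F (suc α) (suc u) ≡ F (α ℕ.+ K) u + F α (suc u)
  F-pascal α zero = arith (+ α) (+ K)
    where
    arith : ∀ a c → (+ 1 + a) - c ≡ + 1 + (a - c)
    arith = solve-∀
  F-pascal α (suc zero) = begin
    + (binom (suc m) 1 ℕ.+ x) - + K * + binom (suc m) 1
      ≡⟨ cong (λ b → + (b ℕ.+ x) - + K * + b) (binom-1 (suc m)) ⟩
    + (suc m ℕ.+ x) - + K * + suc m
      ≡⟨ arith (+ α) (+ k) (+ x) ⟩
    (+ (α ℕ.+ K) - + K) + (+ x - + K * + m)
      ≡⟨ cong (λ b → (+ (α ℕ.+ K) - + K) + (+ x - + K * + b)) (binom-1 m) ⟨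
    F (α ℕ.+ K) 1 + F α 2 ∎
    where
    m = α ℕ.+ k
    x = binom (suc m) 2
    arith : ∀ a c x → (+ 1 + (a + c) + x) - (+ 1 + c) * (+ 1 + (a + c)) ≡
                      (a + (+ 1 + c) - (+ 1 + c)) + (x - (+ 1 + c) * (a + c))
    arith = solve-∀
  F-pascal α (suc (suc u)) = begin
    + (b₁ ℕ.+ b₂) - + K * + (b₃ ℕ.+ b₄)
      ≡⟨ arith (+ b₁) (+ b₂) (+ b₃) (+ b₄) (+ K) ⟩
    (+ b₁ - + K * + b₃) + (+ b₂ - + K * + b₄)
      ≡⟨ cong (λ n → (+ binom (suc n) (suc (suc u)) - + K * + binom n (suc u))
                     + F α (suc (suc (suc u))))
              (top-shift α u) ⟨
    F (α ℕ.+ K) (suc (suc u)) + F α (suc (suc (suc u))) ∎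
    where
    T = top α (suc u)
    b₁ = binom (suc T) (suc (suc u))
    b₂ = binom (suc T) (suc (suc (suc u)))
    b₃ = binom T (suc u)
    b₄ = binom T (suc (suc u))
    arith : ∀ (a b c d x : ℤ) → (a + b) - x * (c + d) ≡ (a - x * c) + (b - x * d)
    arith = solve-∀

  pos-*-cong : ∀ {a b c d} → a ℕ.* b ≡ c ℕ.* d → + a * + b ≡ + c * + d
  pos-*-cong {a} {b} {c} {d} eq =
    trans (sym (ℤP.pos-* a b)) (trans (cong +_ eq) (ℤP.pos-* c d))

  -- Closed form: with s = α - K, (s + K(u+1))·F α (u+1) = s·binom(s + K(u+1), u+1),
  -- i.e. [z^u] W^s = s/(s + Ku)·binom(s + Ku, u).
  F-closed : ∀ α u →
    + (α ℕ.+ u ℕ.* K) * F α (suc u) ≡ (+ α - + K) * + binom (α ℕ.+ u ℕ.* K) (suc u)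
  F-closed α zero = begin
    + (α ℕ.+ 0) * (+ α - + K)          ≡⟨ ℤP.*-comm (+ (α ℕ.+ 0)) (+ α - + K) ⟩
    (+ α - + K) * + (α ℕ.+ 0)          ≡⟨ cong (λ n → (+ α - + K) * + n) (binom-1 (α ℕ.+ 0)) ⟨
    (+ α - + K) * + binom (α ℕ.+ 0) 1  ∎
  F-closed α (suc v) = begin
    + N * (+ X - + K * + Y)
      ≡⟨ distribute (+ N) (+ X) (+ K) (+ Y) ⟩
    + N * + X - + K * (+ N * + Y)
      ≡⟨ cong (λ z → + N * + X - + K * z) absorb ⟩
    + N * + X - + K * (+ suc (suc v) * + X)
      ≡⟨ cong (λ z → (+ α + z) * + X - + K * (+ suc (suc v) * + X)) (ℤP.pos-* (suc v) K) ⟩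
    (+ α + + suc v * + K) * + X - + K * (+ suc (suc v) * + X)
      ≡⟨ collect (+ α) (+ v) (+ K) (+ X) ⟩
    (+ α - + K) * + X
      ≡⟨ cong (λ n → (+ α - + K) * + binom n (suc (suc v))) (top-suc α v) ⟨
    (+ α - + K) * + binom N (suc (suc v)) ∎
    where
    N = α ℕ.+ suc v ℕ.* K
    X = binom (suc (top α v)) (suc (suc v))
    Y = binom (top α v) (suc v)
    absorb : + N * + Y ≡ + suc (suc v) * + X
    absorb = pos-*-cong {N} {Y} {suc (suc v)} {X}
      (trans (cong (ℕ._* Y) (top-suc α v)) (sym (binom-absorb (top α v) (suc v))))
    distribute : ∀ (n x c y : ℤ) → n * (x - c * y) ≡ n * x - c * (n * y)
    distribute = solve-∀
    collect : ∀ (a w c x : ℤ) → (a + (+ 1 + w) * c) * x - c * ((+ 1 + (+ 1 + w)) * x) ≡ (a - c) * x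
    collect = solve-∀

  -- W^0 = 1: all higher coefficients vanish.
  F-unit : ∀ v → F K (suc v) ≡ + 0
  F-unit v = ℤP.*-cancelˡ-≡ (+ (K ℕ.+ v ℕ.* K)) (F K (suc v)) (+ 0) (begin
    + (K ℕ.+ v ℕ.* K) * F K (suc v)  ≡⟨ F-closed K v ⟩
    (+ K - + K) * + b                ≡⟨ cong (_* + b) (ℤP.+-inverseʳ (+ K)) ⟩
    + 0                              ≡⟨ ℤP.*-zeroʳ (+ (K ℕ.+ v ℕ.* K)) ⟨
    + (K ℕ.+ v ℕ.* K) * + 0          ∎)
    where
    b = binom (K ℕ.+ v ℕ.* K) (suc v)

  -- The coefficients of W^-K.
  winv : ℕ → ℤ
  winv = F 0

  winv-closed : ∀ j → + suc j * - winv (suc (suc j)) ≡ + binom (suc j ℕ.* K) (suc (suc j))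
  winv-closed j = ℤP.*-cancelˡ-≡ (+ K) _ _ (begin
    + K * (+ suc j * - w)             ≡⟨ reorder (+ K) (+ suc j) w ⟩
    - (+ suc j * + K * w)             ≡⟨ cong (λ z → - (z * w)) (ℤP.pos-* (suc j) K) ⟨
    - (+ (suc j ℕ.* K) * w)           ≡⟨ cong -_ (F-closed 0 (suc j)) ⟩
    - ((+ 0 - + K) * + b)             ≡⟨ unsign (+ K) (+ b) ⟩
    + K * + b                         ∎)
    where
    w = winv (suc (suc j))
    b = binom (suc j ℕ.* K) (suc (suc j))
    reorder : ∀ c s w → c * (s * - w) ≡ - (s * c * w)
    reorder = solve-∀
    unsign : ∀ c b → - ((+ 0 - c) * b) ≡ c * b
    unsign = solve-∀

  suc-∸ : ∀ {u i} → i ≤ u → suc u ∸ i ≡ suc (u ∸ i)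
  suc-∸ i≤u = ℕP.+-∸-assoc 1 i≤u

  at-diagonal : ∀ (c : ℤ) α u → c * F α (u ∸ u) ≡ c
  at-diagonal c α u = trans (cong (λ n → c * F α n) (ℕP.n∸n≡0 u)) (ℤP.*-identityʳ c)

  scaled-recurrence : ∀ {φ ψ χ : ℕ → ℤ} → (∀ v → φ (suc v) ≡ ψ v + χ (suc v)) →
    ∀ c u i → i ≤ u → c * φ (suc u ∸ i) ≡ c * ψ (u ∸ i) + c * χ (suc u ∸ i)
  scaled-recurrence {φ} {ψ} {χ} rec c u i i≤u = begin
    c * φ (suc u ∸ i)                    ≡⟨ cong (λ n → c * φ n) (suc-∸ i≤u) ⟩
    c * φ (suc (u ∸ i))                  ≡⟨ cong (c *_) (rec (u ∸ i)) ⟩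
    c * (ψ (u ∸ i) + χ (suc (u ∸ i)))    ≡⟨ ℤP.*-distribˡ-+ c (ψ (u ∸ i)) (χ (suc (u ∸ i))) ⟩
    c * ψ (u ∸ i) + c * χ (suc (u ∸ i))
                                         ≡⟨ cong (λ n → c * ψ (u ∸ i) + c * χ n) (suc-∸ i≤u) ⟨
    c * ψ (u ∸ i) + c * χ (suc u ∸ i)    ∎

  -- W^-K · W^b = W^(b-K), coefficientwise.
  convolution : ∀ u b → ∑[ i < suc u ] winv i * F (b ℕ.+ K) (u ∸ i) ≡ F b u
  convolution zero b = refl
  convolution (suc u) zero = begin
    ∑[ i < suc u ] winv i * F K (suc u ∸ i) + winv (suc u) * F K (u ∸ u)
      ≡⟨ cong₂ _+_ (∑-zero (suc u) _ vanish) (at-diagonal (winv (suc u)) K u) ⟩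
    + 0 + winv (suc u)  ≡⟨ ℤP.+-identityˡ (winv (suc u)) ⟩
    winv (suc u)        ∎
    where
    vanish : ∀ i → i < suc u → winv i * F K (suc u ∸ i) ≡ + 0
    vanish i (s≤s i≤u) = begin
      winv i * F K (suc u ∸ i)   ≡⟨ cong (λ n → winv i * F K n) (suc-∸ i≤u) ⟩
      winv i * F K (suc (u ∸ i)) ≡⟨ cong (winv i *_) (F-unit (u ∸ i)) ⟩
      winv i * + 0               ≡⟨ ℤP.*-zeroʳ (winv i) ⟩
      + 0                        ∎
  convolution (suc u) (suc b) = begin
    ∑[ i < suc u ] winv i * F (suc α) (suc u ∸ i) + winv (suc u) * F (suc α) (u ∸ u)
      ≡⟨ cong₂ _+_ split (at-diagonal (winv (suc u)) (suc α) u) ⟩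
    (A + B) + winv (suc u)
      ≡⟨ ℤP.+-assoc A B (winv (suc u)) ⟩
    A + (B + winv (suc u))
      ≡⟨ cong (λ z → A + (B + z)) (at-diagonal (winv (suc u)) α u) ⟨
    A + ∑[ i < suc (suc u) ] winv i * F α (suc u ∸ i)
      ≡⟨ cong₂ _+_ (convolution u α) (convolution (suc u) b) ⟩
    F α u + F b (suc u)
      ≡⟨ F-pascal b u ⟨
    F (suc b) (suc u) ∎
    where
    -- Pascal's recurrence splits every term; the two halves are the convolutions
    -- for (u, b + K) and (u + 1, b), up to their last terms.
    α = b ℕ.+ K
    A = ∑[ i < suc u ] winv i * F (α ℕ.+ K) (u ∸ i)
    B = ∑[ i < suc u ] winv i * F α (suc u ∸ i)
    split : ∑[ i < suc u ] winv i * F (suc α) (suc u ∸ i) ≡ A + B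
    split = trans (∑-cong (suc u) (λ { i (s≤s i≤u) →
                    scaled-recurrence {F (suc α)} {F (α ℕ.+ K)} {F α} (F-pascal α) (winv i) u i i≤u }))
                  (∑-+ (suc u) _ _)

  -- ballot h u = [z^u] W^(h+1).  It counts the paths with u up-steps from height h
  -- (above the floor) to the end height (see count-paths below).
  ballot : ℕ → ℕ → ℤ
  ballot h = F (suc h ℕ.+ K)

  ballot-shift : ∀ h → suc h ℕ.+ K ℕ.+ K ≡ suc (suc h ℕ.+ k) ℕ.+ K
  ballot-shift h = arith h k
    where
    arith : ∀ h c → suc h ℕ.+ suc c ℕ.+ suc c ≡ suc (suc h ℕ.+ c) ℕ.+ suc c
    arith = ℕSolver.solve-∀

  -- First-step decomposition of the ballot numbers: an up-step or a down-step.
  ballot-pascal : ∀ h v → ballot (suc h) (suc v) ≡ ballot (suc h ℕ.+ k) v + ballot h (suc v)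
  ballot-pascal h v =
    trans (F-pascal (suc h ℕ.+ K) v) (cong (λ α → F α v + ballot h (suc v)) (ballot-shift h))

  -- On the floor the first step must go up.
  ballot-floor : ∀ v → ballot 0 (suc v) ≡ ballot k v
  ballot-floor v = begin
    F (suc K) (suc v)            ≡⟨ F-pascal K v ⟩
    F (K ℕ.+ K) v + F K (suc v)  ≡⟨ cong (λ z → F (K ℕ.+ K) v + z) (F-unit v) ⟩
    F (K ℕ.+ K) v + + 0          ≡⟨ ℤP.+-identityʳ (F (K ℕ.+ K) v) ⟩
    F (K ℕ.+ K) v                ∎

  ballot-closed : ∀ h u →
    + suc (K ℕ.* u ℕ.+ h) * ballot h u ≡ + suc h * + binom (suc (K ℕ.* u ℕ.+ h)) u
  ballot-closed h zero = cong (λ n → + suc (n ℕ.+ h) * + 1) (ℕP.*-zeroʳ K)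
  ballot-closed h (suc v) = begin
    + suc (K ℕ.* suc v ℕ.+ h) * ballot h (suc v)
      ≡⟨ cong (λ n → + n * ballot h (suc v)) exponent ⟨
    + (suc h ℕ.+ K ℕ.+ v ℕ.* K) * ballot h (suc v)
      ≡⟨ F-closed (suc h ℕ.+ K) v ⟩
    (+ suc h + + K - + K) * + binom (suc h ℕ.+ K ℕ.+ v ℕ.* K) (suc v)
      ≡⟨ cong₂ (λ a n → a * + binom n (suc v)) (cancel (+ suc h) (+ K)) exponent ⟩
    + suc h * + binom (suc (K ℕ.* suc v ℕ.+ h)) (suc v) ∎
    where
    exponent : suc h ℕ.+ K ℕ.+ v ℕ.* K ≡ suc (K ℕ.* suc v ℕ.+ h)
    exponent = arith h k v
      where
      arith : ∀ h c v → suc h ℕ.+ suc c ℕ.+ v ℕ.* suc c ≡ suc (suc c ℕ.* suc v ℕ.+ h)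
      arith = ℕSolver.solve-∀
    cancel : ∀ a c → a + c - c ≡ a
    cancel = solve-∀

  -- The full convolution with ballot numbers: W^-K · W^(h+1+K) = W^(h+1).
  ballot-convolution : ∀ h r → ∑[ i < suc r ] winv i * ballot (suc h ℕ.+ k) (r ∸ i) ≡ ballot h r
  ballot-convolution h r = trans
    (∑-cong (suc r) (λ i _ → cong (λ α → winv i * F α (r ∸ i)) (sym (ballot-shift h))))
    (convolution r (suc h ℕ.+ K))

  -- For u = m + r it is the
  -- total number of down-steps between the m-th and (m+1)-th up-steps over the paths with
  -- u up-steps from height h (see downs-formula).
  tail : ℕ → ℕ → ℕ → ℤ
  tail r h u = ∑[ i < suc r ] winv i * ballot h (suc u ∸ i)

  tail-pascal : ∀ r h u → r ≤ u → tail r (suc h) (suc u) ≡ tail r (suc h ℕ.+ k) u + tail r h (suc u)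
  tail-pascal r h u r≤u = trans (∑-cong (suc r) split) (∑-+ (suc r) _ _)
    where
    split : ∀ i → i < suc r → winv i * ballot (suc h) (suc (suc u) ∸ i) ≡
                              winv i * ballot (suc h ℕ.+ k) (suc u ∸ i) + winv i * ballot h (suc (suc u) ∸ i)
    split i (s≤s i≤r) = scaled-recurrence {ballot (suc h)} {ballot (suc h ℕ.+ k)} {ballot h}
      (ballot-pascal h) (winv i) (suc u) i (ℕP.≤-trans i≤r (ℕP.m≤n⇒m≤1+n r≤u))

  tail-floor-shift : ∀ r u → r ≤ suc u → tail r k u ≡ tail r 0 (suc u)
  tail-floor-shift r u r≤su = ∑-cong (suc r) shift
    where
    shift : ∀ i → i < suc r → winv i * ballot k (suc u ∸ i) ≡ winv i * ballot 0 (suc (suc u) ∸ i)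
    shift i (s≤s i≤r) = sym (trans
      (cong (λ n → winv i * ballot 0 n) (suc-∸ (ℕP.≤-trans i≤r r≤su)))
      (cong (winv i *_) (ballot-floor (suc u ∸ i))))

  tail-first : ∀ r h → tail r (suc h) r ≡ ballot h r + tail r h r
  tail-first r h = begin
    tail r (suc h) r
      ≡⟨ ∑-cong (suc r) split ⟩
    ∑[ i < suc r ] (winv i * ballot (suc h ℕ.+ k) (r ∸ i) + winv i * ballot h (suc r ∸ i))
      ≡⟨ ∑-+ (suc r) _ _ ⟩
    ∑[ i < suc r ] winv i * ballot (suc h ℕ.+ k) (r ∸ i) + tail r h r
      ≡⟨ cong (_+ tail r h r) (ballot-convolution h r) ⟩
    ballot h r + tail r h r ∎
    where
    split : ∀ i → i < suc r → winv i * ballot (suc h) (suc r ∸ i) ≡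
                              winv i * ballot (suc h ℕ.+ k) (r ∸ i) + winv i * ballot h (suc r ∸ i)
    split i (s≤s i≤r) = scaled-recurrence {ballot (suc h)} {ballot (suc h ℕ.+ k)} {ballot h}
      (ballot-pascal h) (winv i) r i i≤r

  -- Since W^(1-K) = W^-K · W = W^-K + z,
  -- the full convolution Σ_{i ≤ r+2} winv i · ballot 0 (r+2-i) equals winv (r+2), which is
  -- already its last term.
  tail-floor : ∀ r → tail (suc r) 0 (suc r) ≡ + 0
  tail-floor r = identityˡ-unique (tail (suc r) 0 (suc r)) w (begin
    tail (suc r) 0 (suc r) + w
      ≡⟨ cong (λ z → tail (suc r) 0 (suc r) + z) (at-diagonal w (suc K) (suc (suc r))) ⟨
    ∑[ i < suc (suc (suc r)) ] winv i * F (1 ℕ.+ K) (suc (suc r) ∸ i)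
      ≡⟨ convolution (suc (suc r)) 1 ⟩
    F 1 (suc (suc r))
      ≡⟨ F-pascal 0 (suc r) ⟩
    F K (suc r) + w
      ≡⟨ cong (_+ w) (F-unit r) ⟩
    + 0 + w
      ≡⟨ ℤP.+-identityˡ w ⟩
    w ∎)
    where
    w = winv (suc (suc r))

  -- Splitting off the first two terms of a tail, which carry winv 0 = 1 and winv 1 = -K.
  tail-expansion : ∀ h n r → tail (suc r) h n ≡
    (ballot h (suc n) - + K * ballot h n) - ∑[ j < r ] (- (winv (suc (suc j)) * ballot h (n ∸ suc j)))
  tail-expansion h n r = begin
    tail (suc r) h n
      ≡⟨ ∑-head (suc r) f ⟩
    f 0 + (∑[ i < suc r ] f (suc i))
      ≡⟨ cong (λ z → f 0 + z) (∑-head r (λ i → f (suc i))) ⟩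
    f 0 + (f 1 + ∑ g r)
      ≡⟨ arith (ballot h (suc n)) (ballot h n) (+ K) (∑ g r) ⟩
    (ballot h (suc n) - + K * ballot h n) - - ∑ g r
      ≡⟨ cong (λ z → (ballot h (suc n) - + K * ballot h n) - z) (∑-neg r g) ⟨
    (ballot h (suc n) - + K * ballot h n) - ∑[ j < r ] (- g j) ∎
    where
    f : ℕ → ℤ
    f i = winv i * ballot h (suc n ∸ i)
    g : ℕ → ℤ
    g j = winv (suc (suc j)) * ballot h (n ∸ suc j)
    arith : ∀ p q c s → + 1 * p + ((+ 0 - c) * q + s) ≡ (p - c * q) - - s
    arith = solve-∀

-- Heights are measured from the floor
-- y = -t, so a path starts at height t and must end at height t; valid h xs says that xs,
-- started at height h, never goes below the floor and ends at height t.
module Paths (k t : ℕ) (t≤k : t ≤ k) where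
  open FussCatalan k
  open import Data.Nat using (_+_; _*_; _∸_; _≡ᵇ_)
  open import Data.Bool using (Bool; true; false; if_then_else_)
  open import Data.Bool.Properties using (T-≡; if-eta)
  open import Data.List using (List; []; _∷_; _++_; map; foldr; length)
  open import Data.Empty using (⊥; ⊥-elim)
  open import Function.Bundles using (Equivalence)
  import Data.Nat.Tactic.RingSolver as ℕSolver
  open ≡-Reasoning

  valid : ℕ → List Step → Bool
  valid = validFrom k t

  sumOver : (List Step → ℕ) → List (List Step) → ℕ
  sumOver f = foldr (λ xs acc → f xs + acc) 0

  sumOver-++ : ∀ f A B → sumOver f (A ++ B) ≡ sumOver f A + sumOver f B
  sumOver-++ f [] B = refl
  sumOver-++ f (a ∷ A) B = trans (cong (λ z → f a + z) (sumOver-++ f A B)) (sym (ℕP.+-assoc (f a) _ _))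

  sumOver-map : ∀ f g A → sumOver f (map g A) ≡ sumOver (λ xs → f (g xs)) A
  sumOver-map f g [] = refl
  sumOver-map f g (a ∷ A) = cong (λ z → f (g a) + z) (sumOver-map f g A)

  sumOver-allSeqs-suc : ∀ L f → sumOver f (allSeqs (suc L)) ≡
    sumOver (λ xs → f (U ∷ xs)) (allSeqs L) + sumOver (λ xs → f (D ∷ xs)) (allSeqs L)
  sumOver-allSeqs-suc L f = trans (sumOver-++ f (map (U ∷_) (allSeqs L)) (map (D ∷_) (allSeqs L)))
    (cong₂ _+_ (sumOver-map f (U ∷_) (allSeqs L)) (sumOver-map f (D ∷_) (allSeqs L)))

  sumOver-allSeqs-cong : ∀ L {f g} → (∀ xs → length xs ≡ L → f xs ≡ g xs) →
    sumOver f (allSeqs L) ≡ sumOver g (allSeqs L)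
  sumOver-allSeqs-cong zero eq = cong (_+ 0) (eq [] refl)
  sumOver-allSeqs-cong (suc L) {f} {g} eq = begin
    sumOver f (allSeqs (suc L))
      ≡⟨ sumOver-allSeqs-suc L f ⟩
    sumOver (λ xs → f (U ∷ xs)) (allSeqs L) + sumOver (λ xs → f (D ∷ xs)) (allSeqs L)
      ≡⟨ cong₂ _+_ (sumOver-allSeqs-cong L (λ xs len → eq (U ∷ xs) (cong suc len)))
                   (sumOver-allSeqs-cong L (λ xs len → eq (D ∷ xs) (cong suc len))) ⟩
    sumOver (λ xs → g (U ∷ xs)) (allSeqs L) + sumOver (λ xs → g (D ∷ xs)) (allSeqs L)
      ≡⟨ sumOver-allSeqs-suc L g ⟨
    sumOver g (allSeqs (suc L)) ∎

  sumOver-zero : ∀ {f} A → (∀ xs → f xs ≡ 0) → sumOver f A ≡ 0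
  sumOver-zero [] eq = refl
  sumOver-zero (a ∷ A) eq = cong₂ _+_ (eq a) (sumOver-zero A eq)

  sumOver-+ : ∀ f g A → sumOver (λ xs → f xs + g xs) A ≡ sumOver f A + sumOver g A
  sumOver-+ f g [] = refl
  sumOver-+ f g (a ∷ A) =
    trans (cong (λ z → f a + g a + z) (sumOver-+ f g A))
          (interchange (f a) (g a) (sumOver f A) (sumOver g A))
    where
    interchange : ∀ a b c d → a + b + (c + d) ≡ a + c + (b + d)
    interchange = ℕSolver.solve-∀

  pathCount : ℕ → ℕ → ℕ
  pathCount h L = sumOver (λ xs → if valid h xs then 1 else 0) (allSeqs L)

  downsTotal : ℕ → ℕ → ℕ → ℕ
  downsTotal m h L = sumOver (λ xs → if valid h xs then downsAt m xs else 0) (allSeqs L)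

  pathCount-floor : ∀ L → pathCount 0 (suc L) ≡ pathCount k L
  pathCount-floor L = trans (sumOver-allSeqs-suc L _)
    (trans (cong (λ z → pathCount k L + z) (sumOver-zero (allSeqs L) (λ _ → refl))) (ℕP.+-identityʳ _))

  pathCount-step : ∀ h L → pathCount (suc h) (suc L) ≡ pathCount (suc h + k) L + pathCount h L
  pathCount-step h L = sumOver-allSeqs-suc L _

  downs-floor : ∀ m L → downsTotal (suc m) 0 (suc L) ≡ downsTotal m k L
  downs-floor m L = trans (sumOver-allSeqs-suc L _)
    (trans (cong (λ z → downsTotal m k L + z) (sumOver-zero (allSeqs L) (λ _ → refl)))
           (ℕP.+-identityʳ _))

  downs-step : ∀ m h L →
    downsTotal (suc m) (suc h) (suc L) ≡ downsTotal m (suc h + k) L + downsTotal (suc m) h L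
  downs-step m h L = sumOver-allSeqs-suc L _

  -- Before the first up-step: a path starting with U contributes nothing.
  downs-floor-first : ∀ L → downsTotal 0 0 (suc L) ≡ 0
  downs-floor-first L = trans (sumOver-allSeqs-suc L _)
    (cong₂ _+_ (sumOver-zero (allSeqs L) (λ xs → if-eta (valid k xs)))
               (sumOver-zero (allSeqs L) (λ _ → refl)))

  -- ... while a path starting with D contributes that D plus its remaining initial descent.
  downs-first : ∀ h L → downsTotal 0 (suc h) (suc L) ≡ pathCount h L + downsTotal 0 h L
  downs-first h L = begin
    downsTotal 0 (suc h) (suc L)
      ≡⟨ sumOver-allSeqs-suc L _ ⟩
    sumOver (λ xs → if valid (suc h + k) xs then 0 else 0) (allSeqs L) +
      sumOver (λ xs → if valid h xs then suc (downsAt 0 xs) else 0) (allSeqs L)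
      ≡⟨ cong₂ _+_ (sumOver-zero (allSeqs L) (λ xs → if-eta (valid (suc h + k) xs)))
                   (sumOver-allSeqs-cong L (λ xs _ → if-suc (valid h xs))) ⟩
    sumOver (λ xs → (if valid h xs then 1 else 0) + (if valid h xs then downsAt 0 xs else 0)) (allSeqs L)
      ≡⟨ sumOver-+ _ _ (allSeqs L) ⟩
    pathCount h L + downsTotal 0 h L ∎
    where
    if-suc : ∀ b {d} → (if b then suc d else 0) ≡ (if b then 1 else 0) + (if b then d else 0)
    if-suc true = refl
    if-suc false = refl

  no-ascent : ∀ h → h + K * 0 ≡ h
  no-ascent h = trans (cong (λ z → h + z) (ℕP.*-zeroʳ K)) (ℕP.+-identityʳ h)

  -- An up-step raises the height by k and a down-step lowers it by one, so a valid path
  -- from h, which ends at t, satisfies h + K·ups = length + t.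
  height-invariant : ∀ h xs → valid h xs ≡ true → h + K * ups xs ≡ length xs + t
  height-invariant h [] v =
    trans (no-ascent h) (ℕP.≡ᵇ⇒≡ h t (Equivalence.from T-≡ v))
  height-invariant h (U ∷ xs) v = trans (arith h k (ups xs)) (cong suc (height-invariant (h + k) xs v))
    where
    arith : ∀ h c u → h + suc c * suc u ≡ suc (h + c + suc c * u)
    arith = ℕSolver.solve-∀
  height-invariant (suc h) (D ∷ xs) v = cong suc (height-invariant h xs v)

  start-bounded : ∀ h xs → valid h xs ≡ true → h ≤ length xs + t
  start-bounded h xs v = ℕP.≤-trans (ℕP.m≤m+n h _) (ℕP.≤-reflexive (height-invariant h xs v))

  -- A path of length 0 has no up-steps, because t < K.
  no-empty-ascent : ∀ h w → t ≡ h + K * suc w → ⊥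
  no-empty-ascent h w eq = ℕP.<⇒≱ (s≤s t≤k)
    (ℕP.≤-trans (ℕP.≤-trans (ℕP.m≤m*n K (suc w)) (ℕP.m≤n+m _ h)) (ℕP.≤-reflexive (sym eq)))

  pathCount-overshoot : ∀ h L → L + t < h → pathCount h L ≡ 0
  pathCount-overshoot h L lt = trans (sumOver-allSeqs-cong L none) (sumOver-zero (allSeqs L) (λ _ → refl))
    where
    none : ∀ xs → length xs ≡ L → (if valid h xs then 1 else 0) ≡ 0
    none xs len with valid h xs in v
    ... | false = refl
    ... | true = ⊥-elim (ℕP.<⇒≱ lt (subst (h ≤_) (cong (_+ t) len) (start-bounded h xs v)))

  pathCount-empty : ∀ h → h ≡ t → pathCount h 0 ≡ 1
  pathCount-empty h h≡t with h ≡ᵇ t | ℕP.≡⇒≡ᵇ h t h≡t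
  ... | true | _ = refl

  K-suc : ∀ w → K * suc w ≡ suc (k + K * w)
  K-suc w = arith k w
    where
    arith : ∀ c w → suc c * suc w ≡ suc (c + suc c * w)
    arith = ℕSolver.solve-∀

  up-height : ∀ h w → h + K * suc w ≡ suc h + k + K * w
  up-height h w = arith h k w
    where
    arith : ∀ h c w → h + suc c * suc w ≡ suc h + c + suc c * w
    arith = ℕSolver.solve-∀

  count-paths : ∀ L h u → L + t ≡ h + K * u → + pathCount h L ≡ ballot h u
  count-paths zero h zero eq = cong +_ (pathCount-empty h (sym (trans eq (no-ascent h))))
  count-paths zero h (suc w) eq = ⊥-elim (no-empty-ascent h w eq)
  count-paths (suc L) zero zero eq = ⊥-elim (ℕP.1+n≢0 (trans eq (ℕP.*-zeroʳ K)))
  count-paths (suc L) zero (suc w) eq = begin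
    + pathCount 0 (suc L) ≡⟨ cong +_ (pathCount-floor L) ⟩
    + pathCount k L       ≡⟨ count-paths L k w (ℕP.suc-injective (trans eq (K-suc w))) ⟩
    ballot k w            ≡⟨ ballot-floor w ⟨
    ballot 0 (suc w)      ∎
  count-paths (suc L) (suc h) zero eq = begin
    + pathCount (suc h) (suc L)
      ≡⟨ cong +_ (pathCount-step h L) ⟩
    + (pathCount (suc h + k) L + pathCount h L)
      ≡⟨ cong (λ n → + (n + pathCount h L)) (pathCount-overshoot (suc h + k) L overshoot) ⟩
    + pathCount h L
      ≡⟨ count-paths L h 0 (ℕP.suc-injective eq) ⟩
    + 1 ∎
    where
    overshoot : L + t < suc h + k
    overshoot = s≤s (ℕP.≤-trans (ℕP.≤-reflexive (trans (ℕP.suc-injective eq) (no-ascent h)))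
                                (ℕP.m≤m+n h k))
  count-paths (suc L) (suc h) (suc w) eq = begin
    + pathCount (suc h) (suc L)
      ≡⟨ cong +_ (pathCount-step h L) ⟩
    + (pathCount (suc h + k) L + pathCount h L)
      ≡⟨ ℤP.pos-+ (pathCount (suc h + k) L) (pathCount h L) ⟩
    + pathCount (suc h + k) L ℤ.+ + pathCount h L
      ≡⟨ cong₂ ℤ._+_ (count-paths L (suc h + k) w after-up) (count-paths L h (suc w) after-down) ⟩
    ballot (suc h + k) w ℤ.+ ballot h (suc w)
      ≡⟨ ballot-pascal h w ⟨
    ballot (suc h) (suc w) ∎
    where
    after-down : L + t ≡ h + K * suc w
    after-down = ℕP.suc-injective eq
    after-up : L + t ≡ suc h + k + K * w
    after-up = trans after-down (up-height h w)

  downs-formula : ∀ L h m r → L + t ≡ h + K * (m + suc r) →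
    + downsTotal m h L ≡ tail (suc r) h (m + suc r)
  downs-formula zero h m r eq =
    ⊥-elim (no-empty-ascent h (m + r) (trans eq (cong (λ z → h + K * z) (ℕP.+-suc m r))))
  downs-formula (suc L) zero zero r eq = begin
    + downsTotal 0 0 (suc L)  ≡⟨ cong +_ (downs-floor-first L) ⟩
    + 0                       ≡⟨ tail-floor r ⟨
    tail (suc r) 0 (suc r)    ∎
  downs-formula (suc L) (suc h) zero r eq = begin
    + downsTotal 0 (suc h) (suc L)
      ≡⟨ cong +_ (downs-first h L) ⟩
    + (pathCount h L + downsTotal 0 h L)
      ≡⟨ ℤP.pos-+ (pathCount h L) (downsTotal 0 h L) ⟩
    + pathCount h L ℤ.+ + downsTotal 0 h L
      ≡⟨ cong₂ ℤ._+_ (count-paths L h (suc r) eq′) (downs-formula L h 0 r eq′) ⟩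
    ballot h (suc r) ℤ.+ tail (suc r) h (suc r)
      ≡⟨ tail-first (suc r) h ⟨
    tail (suc r) (suc h) (suc r) ∎
    where
    eq′ : L + t ≡ h + K * suc r
    eq′ = ℕP.suc-injective eq
  downs-formula (suc L) zero (suc m) r eq = begin
    + downsTotal (suc m) 0 (suc L)
      ≡⟨ cong +_ (downs-floor m L) ⟩
    + downsTotal m k L
      ≡⟨ downs-formula L k m r (ℕP.suc-injective (trans eq (K-suc (m + suc r)))) ⟩
    tail (suc r) k (m + suc r)
      ≡⟨ tail-floor-shift (suc r) (m + suc r) (ℕP.m≤n⇒m≤1+n (ℕP.m≤n+m (suc r) m)) ⟩
    tail (suc r) 0 (suc m + suc r) ∎
  downs-formula (suc L) (suc h) (suc m) r eq = begin
    + downsTotal (suc m) (suc h) (suc L)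
      ≡⟨ cong +_ (downs-step m h L) ⟩
    + (downsTotal m (suc h + k) L + downsTotal (suc m) h L)
      ≡⟨ ℤP.pos-+ (downsTotal m (suc h + k) L) (downsTotal (suc m) h L) ⟩
    + downsTotal m (suc h + k) L ℤ.+ + downsTotal (suc m) h L
      ≡⟨ cong₂ ℤ._+_ (downs-formula L (suc h + k) m r after-up)
                     (downs-formula L h (suc m) r after-down) ⟩
    tail (suc r) (suc h + k) (m + suc r) ℤ.+ tail (suc r) h (suc m + suc r)
      ≡⟨ tail-pascal (suc r) h (m + suc r) (ℕP.m≤n+m (suc r) m) ⟨
    tail (suc r) (suc h) (suc m + suc r) ∎
    where
    after-down : L + t ≡ h + K * (suc m + suc r)
    after-down = ℕP.suc-injective eq
    after-up : L + t ≡ suc h + k + K * (m + suc r)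
    after-up = trans after-down (up-height h (m + suc r))

  dyck-ups : ∀ n xs → length xs ≡ n * K → valid t xs ≡ true → ups xs ≡ n
  dyck-ups n xs len v = ℕP.*-cancelˡ-≡ (ups xs) n K (ℕP.+-cancelˡ-≡ t _ _ (begin
    t + K * ups xs  ≡⟨ height-invariant t xs v ⟩
    length xs + t   ≡⟨ cong (_+ t) len ⟩
    n * K + t       ≡⟨ ℕP.+-comm (n * K) t ⟩
    t + n * K       ≡⟨ cong (λ z → t + z) (ℕP.*-comm n K) ⟩
    t + K * n       ∎))

  -- s sums over all step sequences of length nK; the Dyck condition there is just validity.
  s-as-downsTotal : ∀ n m → s k t n m ≡ downsTotal m t (n * K)
  s-as-downsTotal n m = sumOver-allSeqs-cong (n * K) same-summand
    where
    same-summand : ∀ xs → length xs ≡ n * K →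
      (if isDyck k t n xs then downsAt m xs else 0) ≡ (if valid t xs then downsAt m xs else 0)
    same-summand xs len with valid t xs in v
    ... | false = refl
    ... | true rewrite Equivalence.to T-≡ (ℕP.≡⇒≡ᵇ (ups xs) n (dyck-ups n xs len v)) = refl

  s-as-tail : ∀ n r → suc r ≤ n → + s k t n (n ∸ suc r) ≡ tail (suc r) t n
  s-as-tail n r r<n = begin
    + s k t n (n ∸ suc r)                    ≡⟨ cong +_ (s-as-downsTotal n (n ∸ suc r)) ⟩
    + downsTotal (n ∸ suc r) t (n * K)       ≡⟨ downs-formula (n * K) t (n ∸ suc r) r length-eq ⟩
    tail (suc r) t (n ∸ suc r + suc r)       ≡⟨ cong (tail (suc r) t) split ⟩
    tail (suc r) t n                         ∎
    where
    split : n ∸ suc r + suc r ≡ n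
    split = ℕP.m∸n+n≡m r<n
    length-eq : n * K + t ≡ t + K * (n ∸ suc r + suc r)
    length-eq = trans (ℕP.+-comm (n * K) t)
                      (cong (λ z → t + z) (trans (ℕP.*-comm n K) (cong (K *_) (sym split))))

-- The embedding of ℤ into ℚ respects the ring operations; each identity is checked on
-- unnormalised fractions, where it holds by integer arithmetic.
module IntegerEmbedding where
  open IntegerSums
  open import Data.Integer using (_+_; _*_; -_; _-_)
  open import Data.Integer.Tactic.RingSolver using (solve-∀)
  import Data.Rational as ℚ
  import Data.Rational.Properties as ℚP
  open import Data.Rational.Unnormalised as ℚᵘ using (mkℚᵘ; *≡*)
  import Data.Rational.Unnormalised.Properties as ℚᵘP
  open ℚᵘP.≃-Reasoning

  ⟦_⟧ : ℤ → ℚ.ℚ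
  ⟦ z ⟧ = z ℚ./ 1

  ⟦⟧-via-ℚᵘ : ∀ {z p} → mkℚᵘ z 0 ℚᵘ.≃ ℚ.toℚᵘ p → ⟦ z ⟧ ≡ p
  ⟦⟧-via-ℚᵘ {z} {p} eq = trans (ℚP.fromℚᵘ-cong eq) (ℚP.fromℚᵘ-toℚᵘ p)

  unnormalise : ∀ z → mkℚᵘ z 0 ℚᵘ.≃ ℚ.toℚᵘ ⟦ z ⟧
  unnormalise z = ℚᵘP.≃-sym (ℚP.toℚᵘ-fromℚᵘ (mkℚᵘ z 0))

  ⟦⟧-+ : ∀ a b → ⟦ a + b ⟧ ≡ ⟦ a ⟧ ℚ.+ ⟦ b ⟧
  ⟦⟧-+ a b = ⟦⟧-via-ℚᵘ (begin
    mkℚᵘ (a + b) 0                     ≈⟨ *≡* (arith a b) ⟩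
    mkℚᵘ a 0 ℚᵘ.+ mkℚᵘ b 0             ≈⟨ ℚᵘP.+-cong (unnormalise a) (unnormalise b) ⟩
    ℚ.toℚᵘ ⟦ a ⟧ ℚᵘ.+ ℚ.toℚᵘ ⟦ b ⟧     ≈⟨ ℚP.toℚᵘ-homo-+ ⟦ a ⟧ ⟦ b ⟧ ⟨
    ℚ.toℚᵘ (⟦ a ⟧ ℚ.+ ⟦ b ⟧)           ∎)
    where
    arith : ∀ a b → (a + b) * + 1 ≡ (a * + 1 + b * + 1) * + 1
    arith = solve-∀

  ⟦⟧-* : ∀ a b → ⟦ a * b ⟧ ≡ ⟦ a ⟧ ℚ.* ⟦ b ⟧
  ⟦⟧-* a b = ⟦⟧-via-ℚᵘ (begin
    mkℚᵘ (a * b) 0                     ≈⟨ *≡* refl ⟩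
    mkℚᵘ a 0 ℚᵘ.* mkℚᵘ b 0             ≈⟨ ℚᵘP.*-cong (unnormalise a) (unnormalise b) ⟩
    ℚ.toℚᵘ ⟦ a ⟧ ℚᵘ.* ℚ.toℚᵘ ⟦ b ⟧     ≈⟨ ℚP.toℚᵘ-homo-* ⟦ a ⟧ ⟦ b ⟧ ⟨
    ℚ.toℚᵘ (⟦ a ⟧ ℚ.* ⟦ b ⟧)           ∎)

  ⟦⟧-neg : ∀ a → ⟦ - a ⟧ ≡ ℚ.- ⟦ a ⟧
  ⟦⟧-neg a = ⟦⟧-via-ℚᵘ (begin
    mkℚᵘ (- a) 0           ≈⟨ *≡* refl ⟩
    ℚᵘ.- mkℚᵘ a 0          ≈⟨ ℚᵘP.-‿cong (unnormalise a) ⟩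
    ℚᵘ.- ℚ.toℚᵘ ⟦ a ⟧      ≈⟨ ℚP.toℚᵘ-homo‿- ⟦ a ⟧ ⟨
    ℚ.toℚᵘ (ℚ.- ⟦ a ⟧)     ∎)

  ⟦⟧-− : ∀ a b → ⟦ a - b ⟧ ≡ ⟦ a ⟧ ℚ.- ⟦ b ⟧
  ⟦⟧-− a b = trans (⟦⟧-+ a (- b)) (cong (λ q → ⟦ a ⟧ ℚ.+ q) (⟦⟧-neg b))

  ⟦⟧-∑ : ∀ (f : ℕ → ℤ) (g : ℕ → ℚ.ℚ) → (∀ j → g j ≡ ⟦ f j ⟧) →
    ∀ n → sumUpTo g n ≡ ⟦ ∑ f n ⟧
  ⟦⟧-∑ f g eq zero = refl
  ⟦⟧-∑ f g eq (suc n) = trans (cong₂ ℚ._+_ (⟦⟧-∑ f g eq n) (eq n)) (sym (⟦⟧-+ (∑ f n) (f n)))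

  fraction : ∀ p q z d → + suc d * z ≡ p * q → (p ℚ./ suc d) ℚ.* ⟦ q ⟧ ≡ ⟦ z ⟧
  fraction p q z d eq = sym (⟦⟧-via-ℚᵘ (begin
    mkℚᵘ z 0
      ≈⟨ *≡* cross ⟩
    mkℚᵘ p d ℚᵘ.* mkℚᵘ q 0
      ≈⟨ ℚᵘP.*-cong (ℚᵘP.≃-sym (ℚP.toℚᵘ-fromℚᵘ (mkℚᵘ p d))) (unnormalise q) ⟩
    ℚ.toℚᵘ (p ℚ./ suc d) ℚᵘ.* ℚ.toℚᵘ ⟦ q ⟧
      ≈⟨ ℚP.toℚᵘ-homo-* (p ℚ./ suc d) ⟦ q ⟧ ⟨
    ℚ.toℚᵘ ((p ℚ./ suc d) ℚ.* ⟦ q ⟧) ∎))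
    where
    cross : z * + (suc d ℕ.* 1) ≡ (p * q) * + 1
    cross = trans (cong (λ n → z * + n) (ℕP.*-identityʳ (suc d)))
              (trans (ℤP.*-comm z (+ suc d)) (trans eq (sym (ℤP.*-identityʳ (p * q)))))

module Coefficients (k t : ℕ) where
  open Binomial
  open IntegerSums
  open FussCatalan k
  open IntegerEmbedding
  open import Data.Nat using (_∸_)
  open import Data.Nat.Combinatorics using (_C_)
  open import Data.Integer using (_+_; _*_; -_; _-_)
  import Data.Rational as ℚ
  import Data.Rational.Properties as ℚP
  open ≡-Reasoning

  Cq-ballot : ∀ u → Cq k u t ≡ ⟦ ballot t u ⟧
  Cq-ballot u = fraction (+ suc t) (+ (suc (K ℕ.* u ℕ.+ t) C u)) (ballot t u) (K ℕ.* u ℕ.+ t)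
    (trans (ballot-closed t u) (cong (λ b → + suc t * + b) (binom≡C (suc (K ℕ.* u ℕ.+ t)) u)))

  term-winv : ∀ n i → term k t n i ≡ ⟦ - (winv (suc (suc i)) * ballot t (n ∸ suc i)) ⟧
  term-winv n i = begin
    (+ 1 ℚ./ suc i) ℚ.* (⟦ + b ⟧ ℚ.* Cq k (n ∸ suc i) t)
      ≡⟨ ℚP.*-assoc (+ 1 ℚ./ suc i) ⟦ + b ⟧ _ ⟨
    ((+ 1 ℚ./ suc i) ℚ.* ⟦ + b ⟧) ℚ.* Cq k (n ∸ suc i) t
      ≡⟨ cong₂ ℚ._*_ (fraction (+ 1) (+ b) (- w) i coefficient) (Cq-ballot (n ∸ suc i)) ⟩
    ⟦ - w ⟧ ℚ.* ⟦ c ⟧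
      ≡⟨ ⟦⟧-* (- w) c ⟨
    ⟦ - w * c ⟧
      ≡⟨ cong ⟦_⟧ (ℤP.neg-distribˡ-* w c) ⟨
    ⟦ - (w * c) ⟧ ∎
    where
    w = winv (suc (suc i))
    c = ballot t (n ∸ suc i)
    b = (suc i ℕ.* K) C (suc (suc i))
    coefficient : + suc i * - w ≡ + 1 * + b
    coefficient = trans (winv-closed i)
      (trans (cong +_ (binom≡C (suc i ℕ.* K) (suc (suc i)))) (sym (ℤP.*-identityˡ (+ b))))

  tail-in-ℚ : ∀ n r → ⟦ tail (suc r) t n ⟧ ≡
    (Cq k (n ℕ.+ 1) t ℚ.- toℚ K ℚ.* Cq k n t) ℚ.- sumTerms k t n (suc r)
  tail-in-ℚ n r = begin
    ⟦ tail (suc r) t n ⟧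
      ≡⟨ cong ⟦_⟧ (tail-expansion t n r) ⟩
    ⟦ (ballot t (suc n) - + K * ballot t n) - ∑ g r ⟧
      ≡⟨ ⟦⟧-− (ballot t (suc n) - + K * ballot t n) (∑ g r) ⟩
    ⟦ ballot t (suc n) - + K * ballot t n ⟧ ℚ.- ⟦ ∑ g r ⟧
      ≡⟨ cong (ℚ._- ⟦ ∑ g r ⟧) (trans (⟦⟧-− (ballot t (suc n)) (+ K * ballot t n))
           (cong (λ q → ⟦ ballot t (suc n) ⟧ ℚ.- q) (⟦⟧-* (+ K) (ballot t n)))) ⟩
    (⟦ ballot t (suc n) ⟧ ℚ.- toℚ K ℚ.* ⟦ ballot t n ⟧) ℚ.- ⟦ ∑ g r ⟧
      ≡⟨ cong₂ (λ a c → (a ℚ.- toℚ K ℚ.* c) ℚ.- ⟦ ∑ g r ⟧) leading (sym (Cq-ballot n)) ⟩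
    (Cq k (n ℕ.+ 1) t ℚ.- toℚ K ℚ.* Cq k n t) ℚ.- ⟦ ∑ g r ⟧
      ≡⟨ cong (λ q → (Cq k (n ℕ.+ 1) t ℚ.- toℚ K ℚ.* Cq k n t) ℚ.- q)
              (⟦⟧-∑ g (term k t n) (term-winv n) r) ⟨
    (Cq k (n ℕ.+ 1) t ℚ.- toℚ K ℚ.* Cq k n t) ℚ.- sumTerms k t n (suc r) ∎
    where
    g : ℕ → ℤ
    g j = - (winv (suc (suc j)) * ballot t (n ∸ suc j))
    leading : ⟦ ballot t (suc n) ⟧ ≡ Cq k (n ℕ.+ 1) t
    leading = trans (sym (Cq-ballot (suc n))) (cong (λ u → Cq k u t) (ℕP.+-comm 1 n))

open import Data.Nat using (ℕ; suc; _≤_; _∸_; _+_)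
open import Data.Rational using (_-_; _*_)
open import Relation.Binary.PropositionalEquality using (_≡_)

corollary3p11 : (k t n r : ℕ) → 1 ≤ k → t ≤ k → 1 ≤ n → 1 ≤ r → r ≤ n →
    toℚ (s k t n (n ∸ r)) ≡
    (Cq k (n + 1) t - (toℚ (suc k) * Cq k n t)) - sumTerms k t n r
corollary3p11 k t n zero _ _ _ () _
corollary3p11 k t n (suc r) _ t≤k _ _ r<n = begin
  toℚ (s k t n (n ∸ suc r))
    ≡⟨ cong ⟦_⟧ (s-as-tail n r r<n) ⟩
  ⟦ tail (suc r) t n ⟧
    ≡⟨ tail-in-ℚ n r ⟩
  (Cq k (n + 1) t - (toℚ (suc k) * Cq k n t)) - sumTerms k t n (suc r) ∎
  where
  open Paths k t t≤k using (s-as-tail)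
  open FussCatalan k using (tail)
  open Coefficients k t using (tail-in-ℚ)
  open IntegerEmbedding using (⟦_⟧)
  open ≡-Reasoning
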